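{- Let $\ell \geq 2$ be an integer. Then monotone $(\ell-1)$-in-$(2\ell-1)$-SAT polynomially transforms to monotone $\ell$-in-$(2\ell)$-SAT.
   Context: For integers $1 \leq \ell \leq k$, monotone $\ell$-in-$k$-SAT is the decision problem: given Boolean variables $x_1, \ldots, x_n$ and a collection of clauses, each consisting of $k$ variables and containing no negated variable, is there a truth assignment to the variables such that exactly $\ell$ of the variables in each clause are true? -}

module Defs where

open import Data.Nat using (ℕ; zero; suc; _+_; _*_; _^_)
open import Data.Bool using (Bool; true; false)
open import Data.Fin using (Fin; zero; suc; toℕ)
open import Data.List using (List; []; _∷_; _++_; replicate; concat; map; length)
open import Data.Vec using (Vec; countᵇ; toList)
open import Data.Maybe using (Maybe; just; nothing)
open import Data.Product using (Σ; _×_; _,_; ∃)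
open import Data.List.Relation.Unary.All using (All)
open import Data.List.Relation.Unary.Unique.Propositional using (Unique)
open import Relation.Binary.PropositionalEquality using (_≡_)
open import Function.Bundles using (_⇔_)

-- An instance on variables x_0 … x_{n-1}: a list of clauses, each clause
-- consisting of k pairwise distinct variables (no negations: monotone).
record Clause (n k : ℕ) : Set where
  constructor clause
  field
    vars     : Vec (Fin n) k
    distinct : Unique (toList vars)

record Instance (k : ℕ) : Set where
  constructor instance'
  field
    nvars   : ℕ
    clauses : List (Clause nvars k)

trueCount : ∀ {n k} → (Fin n → Bool) → Clause n k → ℕ
trueCount σ c = countᵇ σ (Clause.vars c)

InKSat : (ℓ : ℕ) → ∀ {k} → Instance k → Set
InKSat ℓ I = ∃ λ (σ : Fin (Instance.nvars I) → Bool) →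
  All (λ c → trueCount σ c ≡ ℓ) (Instance.clauses I)

-- Encoding of instances as bit strings (self-delimiting unary numbers)

encℕ : ℕ → List Bool
encℕ n = replicate n true ++ (false ∷ [])

encodeInstance : ∀ {k} → Instance k → List Bool
encodeInstance I =
  encℕ (Instance.nvars I) ++ encℕ (length (Instance.clauses I)) ++
  concat (map (λ c → concat (map (λ v → encℕ (toℕ v)) (toList (Clause.vars c))))
              (Instance.clauses I))

-- Deterministic single-tape Turing machines (two-way infinite tape)

-- tape alphabet: zero = blank, 1 = bit false, 2 = bit true, the rest work symbols
Sym : ℕ → Set
Sym w = Fin (3 + w)

data Move : Set where
  L R S : Move

record TM : Set where
  field
    work    : ℕ                 -- number of extra work symbols
    nstates : ℕ                 -- states are Fin (suc nstates), start state zero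
    δ       : Fin (suc nstates) → Sym work →
              Maybe (Fin (suc nstates) × Sym work × Move)  -- nothing = halt

record Config (M : TM) : Set where
  constructor config
  field
    state : Fin (suc (TM.nstates M))
    left  : List (Sym (TM.work M))   -- cells left of head, nearest first
    head  : Sym (TM.work M)
    right : List (Sym (TM.work M))   -- cells right of head, nearest first

blank : ∀ {w} → Sym w
blank = zero

bitSym : ∀ {w} → Bool → Sym w
bitSym false = suc zero
bitSym true  = suc (suc zero)

moveTape : ∀ {M} → Move → Config M → Config M
moveTape L (config q [] h r)       = config q [] blank (h ∷ r)
moveTape L (config q (x ∷ l) h r)  = config q l x (h ∷ r)
moveTape R (config q l h [])       = config q (h ∷ l) blank []
moveTape R (config q l h (x ∷ r))  = config q (h ∷ l) x r
moveTape S c                       = c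

step : (M : TM) → Config M → Maybe (Config M)
step M (config q l h r) with TM.δ M q h
... | nothing            = nothing
... | just (q' , s , mv) = just (moveTape mv (config q' l s r))

-- runFor M t c = just c' iff M started in c halts within t steps in c'
runFor : (M : TM) → ℕ → Config M → Maybe (Config M)
runFor M zero c with step M c
... | nothing = just c
... | just _  = nothing
runFor M (suc t) c with step M c
... | nothing = just c
... | just c' = runFor M t c'

initConfig : (M : TM) → List Bool → Config M
initConfig M []       = config zero [] blank []
initConfig M (b ∷ bs) = config zero [] (bitSym b) (map bitSym bs)

symBit : ∀ {w} → Sym w → Maybe Bool
symBit (suc zero)       = just false
symBit (suc (suc zero)) = just true
symBit _                = nothing

readBits : ∀ {w} → List (Sym w) → List Bool
readBits []       = []
readBits (s ∷ ss) with symBit s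
... | nothing = []
... | just b  = b ∷ readBits ss

-- output: maximal string of bit symbols starting at the head position
output : ∀ {M} → Config M → List Bool
output (config _ _ h r) = readBits (h ∷ r)

-- Polynomial transformation (Garey–Johnson): a function f between instance
-- sets, computable by a Turing machine in time polynomial in the input
-- length (on encodings), with x ∈ A ⇔ f x ∈ B.

record PolyTransform {IA IB : Set}
         (encA : IA → List Bool) (encB : IB → List Bool)
         (A : IA → Set) (B : IB → Set) : Set₁ where
  field
    f        : IA → IB
    machine  : TM
    c d      : ℕ
    computes : ∀ x → ∃ λ cfg →
                 runFor machine (c * suc (length (encA x)) ^ d)
                        (initConfig machine (encA x)) ≡ just cfg
                 × output cfg ≡ encB (f x)
    correct  : ∀ x → A x ⇔ B (f x)

-- Add one fresh variable x₀ to every clause, so that clauses of size 2ℓ - 1 become clauses of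
-- size 2ℓ.  An (ℓ - 1)-in-(2ℓ - 1) solution extends by x₀ = true.  Conversely, complementing an
-- ℓ-in-2ℓ solution again leaves exactly ℓ of the 2ℓ variables of each clause true, so we may
-- assume x₀ = true and drop it.
--
-- On encodings the map is a finite-state transduction: it copies the input and inserts one bit
-- before certain input bits (the extra tally of the variable count, the code 0 of x₀ at the start
-- of each clause, and the tally that shifts each old variable index up by one).  A single-tape
-- machine inserts a bit by shifting the rest of the input one cell to the right, which costs
-- time linear in the input; the output is at most three times as long as the input, so the
-- whole run takes quadratic time.
module Submission where

open import Defs
open import Data.Bool using (Bool; true; false; not; if_then_else_)
open import Data.Fin using (Fin; zero; suc; toℕ; fromℕ; inject₁; _↑ˡ_)
open import Data.Fin.Patterns using (0F; 1F; 2F; 3F)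
import Data.Fin.Properties as Fin
open import Data.Fin.Properties using (toℕ-fromℕ; toℕ-inject₁; +↔⊎; *↔×; 2↔Bool)
open import Data.List as List using (List; []; _∷_; _++_; _ʳ++_; concat; foldr; length; reverse)
open import Data.List.Properties
  using (++-assoc; length-++; length-map; length-reverse; reverse-involutive)
import Data.List.Relation.Unary.All as All
import Data.List.Relation.Unary.All.Properties as All
open import Data.List.Relation.Unary.AllPairs using (_∷_)
open import Data.List.Relation.Unary.Unique.Propositional using (Unique)
import Data.List.Relation.Unary.Unique.Propositional.Properties as Unique
open import Data.Maybe as Maybe using (Maybe; just; nothing)
open import Data.Nat using (ℕ; zero; suc; _+_; _*_; _^_; _∸_; _≤_; z≤n; s≤s)
open import Data.Nat.Properties
open import Data.Nat.Tactic.RingSolver using (solve-∀)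
open import Data.Product using (∃; _×_; _,_)
open import Data.Product.Function.NonDependent.Propositional using (_×-↔_)
open import Data.Sum using (_⊎_; inj₁; inj₂)
open import Data.Sum.Function.Propositional using (_⊎-↔_)
open import Data.Vec as Vec using (Vec; []; _∷_; countᵇ; toList)
import Data.Vec.Functional as Vector
open import Data.Vec.Properties using (toList-map)
open import Function using (_∘_; flip)
open import Function.Bundles using (_⇔_; _↔_; Inverse; mk⇔; mk↔ₛ′)
open import Function.Properties.Inverse using (↔-refl; ↔-sym; ↔-trans)
open import Relation.Binary.PropositionalEquality

-- Padding clauses with a fresh variable

countᵇ-map : ∀ {A B : Set} {m} (p : B → Bool) (f : A → B) (xs : Vec A m) →
             countᵇ p (Vec.map f xs) ≡ countᵇ (p ∘ f) xs
countᵇ-map p f []       = refl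
countᵇ-map p f (x ∷ xs) with p (f x)
... | true  = cong suc (countᵇ-map p f xs)
... | false = countᵇ-map p f xs

countᵇ-not+countᵇ : ∀ {A : Set} {m} (p : A → Bool) (xs : Vec A m) →
                    countᵇ (not ∘ p) xs + countᵇ p xs ≡ m
countᵇ-not+countᵇ p []       = refl
countᵇ-not+countᵇ p (x ∷ xs) with p x
... | true  = trans (+-suc _ _) (cong suc (countᵇ-not+countᵇ p xs))
... | false = cong suc (countᵇ-not+countᵇ p xs)

padClause : ∀ {n k} → Clause n k → Clause (suc n) (suc k)
padClause {n} (clause vs distinct) = clause (zero ∷ Vec.map suc vs) padded-distinct
  where
  padded-distinct : Unique {A = Fin (suc n)} (zero ∷ toList (Vec.map suc vs))
  padded-distinct = subst (Unique ∘ (zero ∷_)) (sym (toList-map suc vs))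
    (All.map⁺ (All.universal (λ _ ()) (toList vs)) ∷ Unique.map⁺ Fin.suc-injective distinct)

padInstance : ∀ {k} → Instance k → Instance (suc k)
padInstance (instance' n cs) = instance' (suc n) (List.map padClause cs)

trueCount-padClause : ∀ {n k} (τ : Fin (suc n) → Bool) (c : Clause n k) → τ zero ≡ true →
                      trueCount τ (padClause c) ≡ suc (trueCount (τ ∘ suc) c)
trueCount-padClause τ (clause vs _) τ₀ rewrite τ₀ = cong suc (countᵇ-map τ suc vs)

module _ {p k : ℕ} (size : suc p + suc p ≡ suc k) where

  trueCount-not : ∀ {n} (τ : Fin n → Bool) (c : Clause n (suc k)) →
                  trueCount τ c ≡ suc p → trueCount (not ∘ τ) c ≡ suc p
  trueCount-not τ c τc = +-cancelʳ-≡ _ _ (suc p) (begin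
    trueCount (not ∘ τ) c + suc p          ≡⟨ cong (trueCount (not ∘ τ) c +_) τc ⟨
    trueCount (not ∘ τ) c + trueCount τ c  ≡⟨ countᵇ-not+countᵇ τ (Clause.vars c) ⟩
    suc k                                  ≡⟨ size ⟨
    suc p + suc p                          ∎)
    where open ≡-Reasoning

  padInstance-correct : (I : Instance k) → InKSat p I ⇔ InKSat (suc p) (padInstance I)
  padInstance-correct (instance' n cs) = mk⇔ extend restrict
    where
    extend : InKSat p (instance' n cs) → InKSat (suc p) (padInstance (instance' n cs))
    extend (σ , sat) = true Vector.∷ σ , All.map⁺ (All.map (λ {c} → padded c) sat)
      where
      padded : ∀ c → trueCount σ c ≡ p → trueCount (true Vector.∷ σ) (padClause c) ≡ suc p
      padded c σc = trans (trueCount-padClause (true Vector.∷ σ) c refl) (cong suc σc)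

    drop-x₀ : (τ : Fin (suc n) → Bool) → τ zero ≡ true →
              All.All (λ c → trueCount τ c ≡ suc p) (List.map padClause cs) →
              InKSat p (instance' n cs)
    drop-x₀ τ τ₀ sat = τ ∘ suc , All.map (λ {c} → unpadded c) (All.map⁻ sat)
      where
      unpadded : ∀ c → trueCount τ (padClause c) ≡ suc p → trueCount (τ ∘ suc) c ≡ p
      unpadded c τc = suc-injective (trans (sym (trueCount-padClause τ c τ₀)) τc)

    restrict : InKSat (suc p) (padInstance (instance' n cs)) → InKSat p (instance' n cs)
    restrict (τ , sat) with τ zero in τ₀
    ... | true  = drop-x₀ τ τ₀ sat
    ... | false = drop-x₀ (not ∘ τ) (cong not τ₀) (All.map (λ {c} → trueCount-not τ c) sat)

-- Lengths of encodings

++-length-≤ : ∀ {A : Set} c (xs xs′ ys ys′ : List A) →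
              length xs′ ≤ c * length xs → length ys′ ≤ c * length ys →
              length (xs′ ++ ys′) ≤ c * length (xs ++ ys)
++-length-≤ c xs xs′ ys ys′ xs′≤ ys′≤ = begin
  length (xs′ ++ ys′)            ≡⟨ length-++ xs′ ⟩
  length xs′ + length ys′        ≤⟨ +-mono-≤ xs′≤ ys′≤ ⟩
  c * length xs + c * length ys  ≡⟨ *-distribˡ-+ c (length xs) _ ⟨
  c * (length xs + length ys)    ≡⟨ cong (c *_) (length-++ xs) ⟨
  c * length (xs ++ ys)          ∎
  where open ≤-Reasoning

code : ∀ {n} → Fin n → List Bool
code v = encℕ (toℕ v)

clauseCode : ∀ {n m} → Clause n m → List Bool
clauseCode c = concat (List.map code (toList (Clause.vars c)))

length-encℕ : ∀ j → length (encℕ j) ≡ suc j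
length-encℕ zero    = refl
length-encℕ (suc j) = cong suc (length-encℕ j)

length-prefixed : ∀ (ps : List Bool) j → length (ps ++ encℕ j) ≤ suc (length ps) * length (encℕ j)
length-prefixed ps j rewrite length-++ ps {encℕ j} | length-encℕ j =
  ≤-trans (≤-reflexive (+-comm (length ps) (suc j))) (+-monoʳ-≤ (suc j) (m≤m*n (length ps) (suc j)))

length-shifted : ∀ {n m} (vs : Vec (Fin n) m) →
                 length (concat (List.map code (toList (Vec.map suc vs))))
                   ≤ 2 * length (concat (List.map code (toList vs)))
length-shifted []       = z≤n
length-shifted (v ∷ vs) =
  ++-length-≤ 2 (code v) (code (suc v))
    (concat (List.map code (toList vs))) (concat (List.map code (toList (Vec.map suc vs))))
    (length-prefixed (true ∷ []) (toℕ v)) (length-shifted vs)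

length-padClause : ∀ {n k} (c : Clause n (suc k)) →
                   length (clauseCode (padClause c)) ≤ 3 * length (clauseCode c)
length-padClause (clause (v ∷ vs) _) =
  ++-length-≤ 3 (code v) (false ∷ code (suc v)) rest shifted
    (length-prefixed (false ∷ true ∷ []) (toℕ v))
    (≤-trans (length-shifted vs) (*-monoˡ-≤ (length rest) (n≤1+n 2)))
  where
  rest    = concat (List.map code (toList vs))
  shifted = concat (List.map code (toList (Vec.map suc vs)))

length-padClauses : ∀ {n k} (cs : List (Clause n (suc k))) →
                    length (concat (List.map clauseCode (List.map padClause cs)))
                      ≤ 3 * length (concat (List.map clauseCode cs))
length-padClauses []       = z≤n
length-padClauses (c ∷ cs) =
  ++-length-≤ 3 (clauseCode c) (clauseCode (padClause c))
    (concat (List.map clauseCode cs)) (concat (List.map clauseCode (List.map padClause cs)))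
    (length-padClause c) (length-padClauses cs)

length-padInstance : ∀ {k} (I : Instance (suc k)) →
                     length (encodeInstance (padInstance I)) ≤ 3 * length (encodeInstance I)
length-padInstance (instance' n cs) rewrite length-map padClause cs =
  ++-length-≤ 3 (encℕ n) (encℕ (suc n)) (encℕ m ++ clauses) (encℕ m ++ padded)
    (≤-trans (length-prefixed (true ∷ []) n) (*-monoˡ-≤ (length (encℕ n)) (n≤1+n 2)))
    (++-length-≤ 3 (encℕ m) (encℕ m) clauses padded (m≤n*m _ 3) (length-padClauses cs))
  where
  m       = length cs
  clauses = concat (List.map clauseCode cs)
  padded  = concat (List.map clauseCode (List.map padClause cs))

-- Runs of Turing machines

module Run (M : TM) where

  -- c ⇒⟨ n ⟩ c′ : c reaches c′ in at most n steps.
  infix 3 _⇒⟨_⟩_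
  data _⇒⟨_⟩_ : Config M → ℕ → Config M → Set where
    done : ∀ {c n} → c ⇒⟨ n ⟩ c
    next : ∀ {c c′ c″ n} → step M c ≡ just c′ → c′ ⇒⟨ n ⟩ c″ → c ⇒⟨ suc n ⟩ c″

  ⇒-weaken : ∀ {c c′ m n} → m ≤ n → c ⇒⟨ m ⟩ c′ → c ⇒⟨ n ⟩ c′
  ⇒-weaken _         done       = done
  ⇒-weaken (s≤s m≤n) (next s r) = next s (⇒-weaken m≤n r)

  infixr 4 _▸_
  _▸_ : ∀ {c c′ c″ m n} → c ⇒⟨ m ⟩ c′ → c′ ⇒⟨ n ⟩ c″ → c ⇒⟨ m + n ⟩ c″
  _▸_ {m = m} done r = ⇒-weaken (m≤n+m _ m) r
  next s r ▸ r′      = next s (r ▸ r′)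

  runFor-⇒ : ∀ {c c′ n} → c ⇒⟨ n ⟩ c′ → step M c′ ≡ nothing → runFor M n c ≡ just c′
  runFor-⇒ {c} {n = zero}  done halted with step M c | halted
  ... | nothing | refl = refl
  runFor-⇒ {c} {n = suc _} done halted with step M c | halted
  ... | nothing | refl = refl
  runFor-⇒ {c} (next s r) halted with step M c | s
  ... | just _ | refl = runFor-⇒ r halted

-- Finite-state transducers and their simulation

module _ {A B : Set} {m n : ℕ} where

  infixr 2 _⊎-Fin_
  _⊎-Fin_ : A ↔ Fin m → B ↔ Fin n → (A ⊎ B) ↔ Fin (m + n)
  e ⊎-Fin f = ↔-trans (e ⊎-↔ f) (↔-sym +↔⊎)

  infixr 3 _×-Fin_
  _×-Fin_ : A ↔ Fin m → B ↔ Fin n → (A × B) ↔ Fin (m * n)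
  e ×-Fin f = ↔-trans (e ×-↔ f) (↔-sym *↔×)

data Action (Q : Set) : Set where
  emit : Bool → Q → Action Q
  read : (Bool → Q) → Action Q

record Transducer : Set₁ where
  field
    State  : Set
    size   : ℕ
    index  : State ↔ Fin (suc size)
    action : State → Action State

  -- initConfig starts every machine in state zero.
  start : State
  start = Inverse.from index zero

module Transduction (T : Transducer) where
  open Transducer T

  -- An emission is only performed in front of a further input bit; at the end of the input the
  -- transducer stops whatever its state.
  infix 3 _⊢_↦_
  data _⊢_↦_ : State → List Bool → List Bool → Set where
    end  : ∀ {q} → q ⊢ [] ↦ []
    emit : ∀ {q b q′ x xs ys} → action q ≡ emit b q′ → q′ ⊢ x ∷ xs ↦ ys → q ⊢ x ∷ xs ↦ b ∷ ys
    read : ∀ {q next x xs ys} → action q ≡ read next → next x ⊢ xs ↦ ys → q ⊢ x ∷ xs ↦ x ∷ ys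

  skip-unary : ∀ {q q′ rest out} → action q ≡ read (λ b → if b then q else q′) →
               q′ ⊢ rest ↦ out → ∀ j → q ⊢ encℕ j ++ rest ↦ encℕ j ++ out
  skip-unary reads d zero    = read reads d
  skip-unary reads d (suc j) = read reads (skip-unary reads d j)

  emit-before-unary : ∀ {q b q′ rest out} → action q ≡ emit b q′ →
                      ∀ j → q′ ⊢ encℕ j ++ rest ↦ out → q ⊢ encℕ j ++ rest ↦ b ∷ out
  emit-before-unary emits zero    d = emit emits d
  emit-before-unary emits (suc j) d = emit emits d

module Simulation (T : Transducer) where
  open Transducer T
  open Transduction T

  -- shift c b q carries the displaced bit c to the right; back b q returns to the mark, where
  -- the pending bit b is written before the simulation resumes in state q.
  data Phase : Set where
    scan   : State → Phase
    shift  : Bool → Bool → State → Phase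
    back   : Bool → State → Phase
    rewind : Phase
    halt   : Phase

  phases : Phase ↔ (State ⊎ (Bool × Bool × State) ⊎ (Bool × State) ⊎ Bool)
  phases = mk↔ₛ′ to from
    (λ { (inj₁ _) → refl ; (inj₂ (inj₁ _)) → refl ; (inj₂ (inj₂ (inj₁ _))) → refl
       ; (inj₂ (inj₂ (inj₂ false))) → refl ; (inj₂ (inj₂ (inj₂ true))) → refl })
    (λ { (scan _) → refl ; (shift _ _ _) → refl ; (back _ _) → refl ; rewind → refl ; halt → refl })
    where
    to : Phase → State ⊎ (Bool × Bool × State) ⊎ (Bool × State) ⊎ Bool
    to (scan q)      = inj₁ q
    to (shift c b q) = inj₂ (inj₁ (c , b , q))
    to (back b q)    = inj₂ (inj₂ (inj₁ (b , q)))
    to rewind        = inj₂ (inj₂ (inj₂ false))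
    to halt          = inj₂ (inj₂ (inj₂ true))
    from : State ⊎ (Bool × Bool × State) ⊎ (Bool × State) ⊎ Bool → Phase
    from (inj₁ q)                     = scan q
    from (inj₂ (inj₁ (c , b , q)))    = shift c b q
    from (inj₂ (inj₂ (inj₁ (b , q)))) = back b q
    from (inj₂ (inj₂ (inj₂ false)))   = rewind
    from (inj₂ (inj₂ (inj₂ true)))    = halt

  phaseCount : ℕ
  phaseCount = size + (2 * (2 * suc size) + (2 * suc size + 2))

  Phase↔Fin : Phase ↔ Fin (suc phaseCount)
  Phase↔Fin = ↔-trans phases
    (index ⊎-Fin (bool ×-Fin bool ×-Fin index) ⊎-Fin (bool ×-Fin index) ⊎-Fin bool)
    where bool = ↔-sym 2↔Bool

  encode : Phase → Fin (suc phaseCount)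
  encode = Inverse.to Phase↔Fin

  decode : Fin (suc phaseCount) → Phase
  decode = Inverse.from Phase↔Fin

  encode-scan-start : encode (scan start) ≡ zero
  encode-scan-start = cong (_↑ˡ _) (Inverse.strictlyInverseˡ index zero)

  Symbol : Set
  Symbol = Sym 1

  mark : Symbol
  mark = suc (suc (suc zero))

  Transition : Set
  Transition = Maybe (Phase × Symbol × Move)

  scanning : Action State → Bool → Transition
  scanning (read next) x = just (scan (next x) , bitSym x , R)
  scanning (emit b q)  x = just (shift x b q , mark , R)

  onBlank : Phase → Transition
  onBlank (scan _)      = just (rewind , blank , L)
  onBlank (shift c b q) = just (back b q , bitSym c , L)
  onBlank rewind        = just (halt , blank , R)
  onBlank _             = nothing

  onBit : Phase → Bool → Transition
  onBit (scan q)      x = scanning (action q) x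
  onBit (shift c b q) x = just (shift x b q , bitSym c , R)
  onBit (back b q)    x = just (back b q , bitSym x , L)
  onBit rewind        x = just (rewind , bitSym x , L)
  onBit halt          _ = nothing

  onMark : Phase → Transition
  onMark (back b q) = just (scan q , bitSym b , R)
  onMark _          = nothing

  transition : Phase → Symbol → Transition
  transition s zero                   = onBlank s
  transition s (suc zero)             = onBit s false
  transition s (suc (suc zero))       = onBit s true
  transition s (suc (suc (suc zero))) = onMark s

  transition-bit : ∀ s x → transition s (bitSym x) ≡ onBit s x
  transition-bit s false = refl
  transition-bit s true  = refl

  transition-halt : ∀ σ → transition halt σ ≡ nothing
  transition-halt zero                   = refl
  transition-halt (suc zero)             = refl
  transition-halt (suc (suc zero))       = refl
  transition-halt (suc (suc (suc zero))) = refl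

  machine : TM
  machine = record
    { work    = 1
    ; nstates = phaseCount
    ; δ       = λ i σ → Maybe.map (λ (s , σ′ , m) → encode s , σ′ , m) (transition (decode i) σ)
    }

  open Run machine

  step-transition : ∀ {s σ s′ σ′ m} l r → transition s σ ≡ just (s′ , σ′ , m) →
                    step machine (config (encode s) l σ r)
                      ≡ just (moveTape m (config (encode s′) l σ′ r))
  step-transition {s} l r t rewrite Inverse.strictlyInverseʳ Phase↔Fin s | t = refl

  step-halt : ∀ l σ r → step machine (config (encode halt) l σ r) ≡ nothing
  step-halt l σ r rewrite Inverse.strictlyInverseʳ Phase↔Fin halt | transition-halt σ = refl

  place : Phase → List Symbol → List Symbol → Config machine
  place s l []      = config (encode s) l blank []
  place s l (σ ∷ r) = config (encode s) l σ r

  bits : List Bool → List Symbol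
  bits = List.map bitSym

  step-right : ∀ s {σ s′ σ′} l xs → transition s σ ≡ just (s′ , σ′ , R) →
               config (encode s) l σ (bits xs) ⇒⟨ 1 ⟩ place s′ (σ′ ∷ l) (bits xs)
  step-right s {σ} l []      t = next (step-transition {s} {σ} l [] t) done
  step-right s {σ} l (_ ∷ _) t = next (step-transition {s} {σ} l _ t) done

  step-left : ∀ s {σ s′ σ′} σₗ l r → transition s σ ≡ just (s′ , σ′ , L) →
              config (encode s) (σₗ ∷ l) σ r ⇒⟨ 1 ⟩ config (encode s′) l σₗ (σ′ ∷ r)
  step-left s {σ} _ _ r t = next (step-transition {s} {σ} _ r t) done

  module _ (b : Bool) (q : State) where

    backing : ∀ l us y zs →
              place (back b q) (bits us ++ mark ∷ l) (bits (y ∷ zs))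
                ⇒⟨ suc (length us) ⟩ place (back b q) l (mark ∷ bits (us ʳ++ y ∷ zs))
    backing l []       y zs = step-left (back b q) mark l _ (transition-bit (back b q) y)
    backing l (u ∷ us) y zs =
      step-left (back b q) (bitSym u) _ _ (transition-bit (back b q) y) ▸ backing l us u (y ∷ zs)

    shifting : ∀ l c us ys →
               place (shift c b q) (bits us ++ mark ∷ l) (bits ys)
                 ⇒⟨ 1 + 2 * length ys + length us ⟩ place (back b q) l (mark ∷ bits (us ʳ++ c ∷ ys))
    shifting l c []       []       = step-left (shift c b q) mark l [] refl
    shifting l c (u ∷ us) []       =
      step-left (shift c b q) (bitSym u) _ [] refl ▸ backing l us u (c ∷ [])
    shifting l c us       (y ∷ ys) =
      ⇒-weaken (≤-reflexive (cost (length ys) (length us)))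
        (step-right (shift c b q) _ ys (transition-bit (shift c b q) y) ▸ shifting l y (c ∷ us) ys)
      where
      cost : ∀ m n → 1 + (1 + 2 * m + suc n) ≡ 1 + 2 * suc m + n
      cost = solve-∀

  emitting : ∀ {q b q′} acc x xs → action q ≡ emit b q′ →
             place (scan q) (bits acc) (bits (x ∷ xs))
               ⇒⟨ 2 * length (x ∷ xs) + 1 ⟩ place (scan q′) (bits (b ∷ acc)) (bits (x ∷ xs))
  emitting {q} {b} {q′} acc x xs emits =
    ⇒-weaken (≤-reflexive (cost (length xs)))
      (step-right (scan q) _ xs (trans (transition-bit (scan q) x) (cong (flip scanning x) emits))
       ▸ shifting b q′ _ x [] xs
       ▸ step-right (back b q′) _ (x ∷ xs) refl)
    where
    cost : ∀ m → 1 + ((1 + 2 * m + 0) + 1) ≡ 2 * suc m + 1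
    cost = solve-∀

  reading : ∀ {q next} acc x xs → action q ≡ read next →
            place (scan q) (bits acc) (bits (x ∷ xs))
              ⇒⟨ 1 ⟩ place (scan (next x)) (bits (x ∷ acc)) (bits xs)
  reading {q} acc x xs reads =
    step-right (scan q) _ xs (trans (transition-bit (scan q) x) (cong (flip scanning x) reads))

  charge-bit : ∀ {c D} k → c ≤ D → c + (k * D + 1) ≤ suc k * D + 1
  charge-bit {c} k c≤D = ≤-trans (≤-reflexive (sym (+-assoc c _ 1))) (+-monoˡ-≤ 1 (+-monoˡ-≤ _ c≤D))

  simulating : ∀ {q xs ys n} → q ⊢ xs ↦ ys → length xs ≤ n → ∀ acc →
               place (scan q) (bits acc) (bits xs)
                 ⇒⟨ length ys * (2 * n + 1) + 1 ⟩
               moveTape L (config (encode rewind) (bits (ys ʳ++ acc)) blank [])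
  simulating {q} end _ acc = next (step-transition {scan q} {blank} _ [] refl) done
  simulating (emit {b = b} {x = x} {xs} {ys} emits d) ∣xs∣≤n acc =
    ⇒-weaken (charge-bit (length ys) (+-monoˡ-≤ 1 (*-monoʳ-≤ 2 ∣xs∣≤n)))
      (emitting acc x xs emits ▸ simulating d ∣xs∣≤n (b ∷ acc))
  simulating {n = n} (read {x = x} {xs} {ys} reads d) (s≤s ∣xs∣≤n) acc =
    ⇒-weaken (charge-bit (length ys) (m≤n+m 1 (2 * n)))
      (reading acc x xs reads ▸ simulating d (≤-trans ∣xs∣≤n (n≤1+n _)) (x ∷ acc))

  rewinding : ∀ us w ws →
              place rewind (bits us) (bits (w ∷ ws) ++ blank ∷ [])
                ⇒⟨ length us + 2 ⟩ place halt (blank ∷ []) (bits (us ʳ++ w ∷ ws) ++ blank ∷ [])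
  rewinding []       w ws =
    next (step-transition {rewind} {bitSym w} [] _ (transition-bit rewind w))
      (next (step-transition {rewind} {blank} [] _ refl) done)
  rewinding (u ∷ us) w ws =
    step-left rewind (bitSym u) _ _ (transition-bit rewind w) ▸ rewinding us u (w ∷ ws)

  returning : ∀ zs → moveTape L (config (encode rewind) (bits zs) blank [])
                       ⇒⟨ length zs + 2 ⟩ place halt (blank ∷ []) (bits (reverse zs) ++ blank ∷ [])
  returning []       = next (step-transition {rewind} {blank} [] _ refl) done
  returning (z ∷ zs) = ⇒-weaken (n≤1+n _) (rewinding zs z [])

  halted : ∀ l σs → step machine (place halt l σs) ≡ nothing
  halted l []      = step-halt l blank []
  halted l (σ ∷ r) = step-halt l σ r

  output-place : ∀ s l σs → output (place s l σs) ≡ readBits σs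
  output-place s l []      = refl
  output-place s l (_ ∷ _) = refl

  readBits-bits : ∀ zs → readBits (bits zs ++ blank ∷ []) ≡ zs
  readBits-bits []           = refl
  readBits-bits (false ∷ zs) = cong (false ∷_) (readBits-bits zs)
  readBits-bits (true ∷ zs)  = cong (true ∷_) (readBits-bits zs)

  initConfig-place : ∀ xs → initConfig machine xs ≡ place (scan start) [] (bits xs)
  initConfig-place []       = cong (λ i → config i [] blank []) (sym encode-scan-start)
  initConfig-place (x ∷ xs) = cong (λ i → config i [] (bitSym x) (bits xs)) (sym encode-scan-start)

  machine-computes : ∀ {xs ys t} → start ⊢ xs ↦ ys → length ys * (2 * length xs + 2) + 3 ≤ t →
                     ∃ λ c → runFor machine t (initConfig machine xs) ≡ just c × output c ≡ ys
  machine-computes {xs} {ys} d bound =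
    final , runFor-⇒ (⇒-weaken (≤-trans (≤-reflexive total) bound) run) (halted _ cells) , output-final
    where
    cells = bits (reverse (reverse ys)) ++ blank ∷ []
    final = place halt (blank ∷ []) cells
    time  = length ys * (2 * length xs + 1) + 1 + (length (reverse ys) + 2)

    run : initConfig machine xs ⇒⟨ time ⟩ final
    run rewrite initConfig-place xs = simulating d ≤-refl [] ▸ returning (reverse ys)

    output-final : output final ≡ ys
    output-final = begin
      output final           ≡⟨ output-place halt _ cells ⟩
      readBits cells         ≡⟨ readBits-bits (reverse (reverse ys)) ⟩
      reverse (reverse ys)   ≡⟨ reverse-involutive ys ⟩
      ys                     ∎
      where open ≡-Reasoning

    total : time ≡ length ys * (2 * length xs + 2) + 3
    total rewrite length-reverse ys = arithmetic (length ys) (length xs)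
      where
      arithmetic : ∀ a n → a * (2 * n + 1) + 1 + (a + 2) ≡ a * (2 * n + 2) + 3
      arithmetic = solve-∀

-- The padding transducer

concat-map-++ : ∀ {A B : Set} (f : A → List B) xs ys →
                concat (List.map f xs) ++ ys ≡ foldr (λ x → f x ++_) ys xs
concat-map-++ f []       ys = refl
concat-map-++ f (x ∷ xs) ys = trans (++-assoc (f x) _ ys) (cong (f x ++_) (concat-map-++ f xs ys))

module Padder (k : ℕ) where

  -- In varStart r and inVar r, r variables of the current clause follow the one being read.
  data PadState : Set where
    bumpVarCount readVarCount readClauseCount clauseStart : PadState
    varStart inVar : Fin (suc k) → PadState

  afterVar : Fin (suc k) → PadState
  afterVar zero    = clauseStart
  afterVar (suc r) = varStart (inject₁ r)

  padAction : PadState → Action PadState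
  padAction bumpVarCount    = emit true readVarCount
  padAction readVarCount    = read (λ b → if b then readVarCount else readClauseCount)
  padAction readClauseCount = read (λ b → if b then readClauseCount else clauseStart)
  padAction clauseStart     = emit false (varStart (fromℕ k))
  padAction (varStart r)    = emit true (inVar r)
  padAction (inVar r)       = read (λ b → if b then inVar r else afterVar r)

  padStates : PadState ↔ Fin (4 + (suc k + suc k))
  padStates = ↔-trans (mk↔ₛ′ to from to∘from from∘to) (↔-refl ⊎-Fin ↔-refl ⊎-Fin ↔-refl)
    where
    to : PadState → Fin 4 ⊎ Fin (suc k) ⊎ Fin (suc k)
    to bumpVarCount    = inj₁ 0F
    to readVarCount    = inj₁ 1F
    to readClauseCount = inj₁ 2F
    to clauseStart     = inj₁ 3F
    to (varStart r)    = inj₂ (inj₁ r)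
    to (inVar r)       = inj₂ (inj₂ r)
    from : Fin 4 ⊎ Fin (suc k) ⊎ Fin (suc k) → PadState
    from (inj₁ 0F)       = bumpVarCount
    from (inj₁ 1F)       = readVarCount
    from (inj₁ 2F)       = readClauseCount
    from (inj₁ 3F)       = clauseStart
    from (inj₂ (inj₁ r)) = varStart r
    from (inj₂ (inj₂ r)) = inVar r
    to∘from : ∀ i → to (from i) ≡ i
    to∘from (inj₁ 0F)       = refl
    to∘from (inj₁ 1F)       = refl
    to∘from (inj₁ 2F)       = refl
    to∘from (inj₁ 3F)       = refl
    to∘from (inj₂ (inj₁ _)) = refl
    to∘from (inj₂ (inj₂ _)) = refl
    from∘to : ∀ s → from (to s) ≡ s
    from∘to bumpVarCount    = refl
    from∘to readVarCount    = refl
    from∘to readClauseCount = refl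
    from∘to clauseStart     = refl
    from∘to (varStart _)    = refl
    from∘to (inVar _)       = refl

  padder : Transducer
  padder = record
    { State = PadState ; size = 3 + (suc k + suc k) ; index = padStates ; action = padAction }

  open Transduction padder

  codes : ∀ {n} → List (Fin n) → List Bool → List Bool
  codes vs rest = foldr (λ v → code v ++_) rest vs

  pads-variables : ∀ {n j rest out} (r : Fin (suc k)) → toℕ r ≡ j → (vs : Vec (Fin n) (suc j)) →
                   clauseStart ⊢ rest ↦ out →
                   varStart r ⊢ codes (toList vs) rest ↦ codes (toList (Vec.map suc vs)) out
  pads-variables zero    refl (v ∷ [])      d =
    emit-before-unary refl (toℕ v) (skip-unary refl d (toℕ v))
  pads-variables (suc r) refl (v ∷ v′ ∷ vs) d =
    emit-before-unary refl (toℕ v)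
      (skip-unary refl (pads-variables (inject₁ r) (toℕ-inject₁ r) (v′ ∷ vs) d) (toℕ v))

  pads-clause : ∀ {n rest out} (c : Clause n (suc k)) → clauseStart ⊢ rest ↦ out →
                clauseStart ⊢ clauseCode c ++ rest ↦ clauseCode (padClause c) ++ out
  pads-clause {rest = rest} {out} (clause (v ∷ vs) _) d =
    subst₂ (clauseStart ⊢_↦_) (sym (concat-map-++ code (toList (v ∷ vs)) rest))
                              (sym (concat-map-++ code (toList (zero ∷ Vec.map suc (v ∷ vs))) out))
      (emit-before-unary refl (toℕ v) (pads-variables (fromℕ k) (toℕ-fromℕ k) (v ∷ vs) d))

  pads-clauses : ∀ {n} (cs : List (Clause n (suc k))) →
                 clauseStart ⊢ concat (List.map clauseCode cs)
                             ↦ concat (List.map clauseCode (List.map padClause cs))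
  pads-clauses []       = end
  pads-clauses (c ∷ cs) = pads-clause c (pads-clauses cs)

  pads-instance : (I : Instance (suc k)) →
                  bumpVarCount ⊢ encodeInstance I ↦ encodeInstance (padInstance I)
  pads-instance (instance' n cs) rewrite length-map padClause cs =
    emit-before-unary refl n (skip-unary refl (skip-unary refl (pads-clauses cs) (length cs)) n)

quadratic-time : ∀ m n → m ≤ 3 * n → m * (2 * n + 2) + 3 ≤ 9 * suc n ^ 2
quadratic-time m n m≤3n =
  ≤-trans (+-monoˡ-≤ 3 (*-monoˡ-≤ (2 * n + 2) m≤3n))
          (≤-trans (m≤m+n _ (3 * n * n + 12 * n + 6)) (≤-reflexive (arithmetic n)))
  where
  arithmetic : ∀ n → 3 * n * (2 * n + 2) + 3 + (3 * n * n + 12 * n + 6) ≡ 9 * (suc n * (suc n * 1))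
  arithmetic = solve-∀

paddingTransform : ∀ p k → suc p + suc p ≡ suc (suc k) →
                   PolyTransform (encodeInstance {suc k}) (encodeInstance {suc (suc k)})
                                 (InKSat p) (InKSat (suc p))
paddingTransform p k size = record
  { f        = padInstance
  ; machine  = machine
  ; c        = 9
  ; d        = 2
  ; computes = λ I → machine-computes (pads-instance I)
                       (quadratic-time _ (length (encodeInstance I)) (length-padInstance I))
  ; correct  = padInstance-correct size
  }
  where
  open Padder k
  open Simulation padder

mainTheorem8 : (ℓ : ℕ) → 2 ≤ ℓ →
    PolyTransform (encodeInstance {2 * ℓ ∸ 1}) (encodeInstance {2 * ℓ})
                  (InKSat (ℓ ∸ 1)) (InKSat ℓ)
mainTheorem8 (suc (suc a)) (s≤s (s≤s z≤n)) =
  paddingTransform (suc a) _ (cong (λ z → suc (suc (a + suc (suc z)))) (sym (+-identityʳ a)))
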